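{- Let $G$ be an Abelian group. Then two vertices $A,B$ of $\Delta 334(G)$ are adjacent if and only if $A^{ -1}=B$.
   Context: For a group $G$ with identity $e$, the 334-triangle graph $\Delta 334(G)$ is the undirected graph (loops allowed) whose vertices are the elements $a\in G$ with $a^3=e$, with an edge between vertices $a$ and $b$ (possibly $a=b$) if and only if $(ab)^4=e$. -}

module Defs where

open import Level using (_⊔_)
open import Data.Nat using (ℕ; zero; suc)
open import Algebra.Bundles using (Group)

module Δ334 {c ℓ} (G : Group c ℓ) where
  open Group G

  _^_ : Carrier → ℕ → Carrier
  x ^ zero  = ε
  x ^ suc n = x ∙ (x ^ n)

  IsVertex : Carrier → Set ℓ
  IsVertex a = (a ^ 3) ≈ ε

  -- vertices a, b are adjacent (loops allowed) iff (ab)⁴ = e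
  Adjacent : Carrier → Carrier → Set ℓ
  Adjacent a b = ((a ∙ b) ^ 4) ≈ ε

{-# OPTIONS --safe #-}
module Submission where

-- In an abelian group powers distribute over products, so the product ab of
-- two elements of order dividing 3 again satisfies (ab)³ = e, whence
-- (ab)⁴ = ab. Adjacency (ab)⁴ = e therefore says ab = e, i.e. b = a⁻¹.

open import Defs
open import Algebra.Bundles using (AbelianGroup; Group)
open import Data.Nat.Base using (zero; suc)
open import Function.Bundles using (_⇔_; mk⇔; module Equivalence)
import Algebra.Properties.CommutativeSemigroup as CommutativeSemigroupProperties
import Algebra.Properties.Group as GroupProperties
import Relation.Binary.Reasoning.Setoid as SetoidReasoning

module PowerProperties {c ℓ} (G : Group c ℓ) where
  open Group G
  open Δ334 G
  open SetoidReasoning setoid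

  ^-suc-of-order : ∀ {x} n → x ^ n ≈ ε → x ^ suc n ≈ x
  ^-suc-of-order {x} n xⁿ≈ε = begin
    x ∙ x ^ n ≈⟨ ∙-congˡ xⁿ≈ε ⟩
    x ∙ ε     ≈⟨ identityʳ x ⟩
    x         ∎

module AbelianPowerProperties {c ℓ} (G : AbelianGroup c ℓ) where
  open AbelianGroup G
  open Δ334 group
  open CommutativeSemigroupProperties commutativeSemigroup using (interchange)
  open SetoidReasoning setoid

  ^-distrib-∙ : ∀ x y n → (x ∙ y) ^ n ≈ x ^ n ∙ y ^ n
  ^-distrib-∙ x y zero    = sym (identityˡ ε)
  ^-distrib-∙ x y (suc n) = begin
    (x ∙ y) ∙ (x ∙ y) ^ n       ≈⟨ ∙-congˡ (^-distrib-∙ x y n) ⟩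
    (x ∙ y) ∙ (x ^ n ∙ y ^ n)   ≈⟨ interchange x y (x ^ n) (y ^ n) ⟩
    (x ∙ x ^ n) ∙ (y ∙ y ^ n)   ∎

module AbelianΔ334 {c ℓ} (G : AbelianGroup c ℓ) where
  open AbelianGroup G
  open Δ334 group
  open AbelianPowerProperties G using (^-distrib-∙)
  open PowerProperties group using (^-suc-of-order)
  open SetoidReasoning setoid

  vertex-∙ : ∀ {a b} → IsVertex a → IsVertex b → IsVertex (a ∙ b)
  vertex-∙ {a} {b} a³≈ε b³≈ε = begin
    (a ∙ b) ^ 3    ≈⟨ ^-distrib-∙ a b 3 ⟩
    a ^ 3 ∙ b ^ 3  ≈⟨ ∙-cong a³≈ε b³≈ε ⟩
    ε ∙ ε          ≈⟨ identityˡ ε ⟩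
    ε              ∎

  adjacent⇔∙≈ε : ∀ {a b} → IsVertex a → IsVertex b → Adjacent a b ⇔ (a ∙ b ≈ ε)
  adjacent⇔∙≈ε {a} {b} a³≈ε b³≈ε = mk⇔ (trans (sym [ab]⁴≈ab)) (trans [ab]⁴≈ab)
    where
    [ab]⁴≈ab : (a ∙ b) ^ 4 ≈ a ∙ b
    [ab]⁴≈ab = ^-suc-of-order 3 (vertex-∙ a³≈ε b³≈ε)

lemma3 : ∀ {c ℓ} (G : AbelianGroup c ℓ) →
    let open AbelianGroup G
        open Δ334 group
    in (A B : Carrier) → IsVertex A → IsVertex B →
       (Adjacent A B ⇔ (A ⁻¹ ≈ B))
lemma3 G A B hA hB = mk⇔
  (λ adj → sym (inverseʳ-unique A B (to adj)))
  (λ A⁻¹≈B → from (trans (∙-congˡ (sym A⁻¹≈B)) (inverseʳ A)))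
  where
  open AbelianGroup G
  open GroupProperties group using (inverseʳ-unique)
  open Equivalence (AbelianΔ334.adjacent⇔∙≈ε G hA hB)
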